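{- Fix a positive integer $\ell$, a set $L\subseteq[0,\ell-1]$ and a set $R_0\subseteq[0,\ell-1]$. For an integer $r>2\ell$, let $R=R_0+(r-\ell)\subseteq[r-\ell,r-1]$, let $M$ be a uniformly random subset of $[\ell,r-\ell-1]$ (each of the $2^{r-2\ell}$ subsets equally likely), and let $S=L\cup M\cup R\subseteq\{0,1,\dots,r-1\}$. Then for every $\varepsilon>0$ there exists $r_0$ such that for all $r\ge r_0$, $$\mathbb{P}\big([2\ell-1,2r-2\ell-1]\subseteq S+S\big)\ \ge\ 1-6\big(2^{ -|L|}+2^{ -|R|}\big)-\varepsilon.$$
   Context: For integers $a\le b$, $[a,b]=\{x\in\mathbb{Z}:a\le x\le b\}$. For a set $A$ of integers, $A+A=\{x+y:x,y\in A\}$ and $A+t=\{x+t:x\in A\}$.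
   Formalization: The parameter ε ranges over the positive rationals. -}

module Defs where

open import Data.Bool using (Bool; true; false; _∧_; _∨_; if_then_else_)
open import Data.Nat using (ℕ; zero; suc; _+_; _*_; _∸_; _^_; _<ᵇ_; _≤ᵇ_)
open import Data.Nat.Properties using (m^n≢0)
open import Data.Vec using (Vec; []; _∷_)
open import Data.List using (List; []; _∷_; map; _++_; length; filter; upTo)
open import Data.Bool.ListAction using (any; all)
open import Data.Integer using (+_)
open import Data.Rational using (ℚ; _/_)
open import Data.Bool using (T?)

-- A finite set of naturals is given by its characteristic function ℕ → Bool.
-- Subsets of [0, n-1] are encoded as Vec Bool n (bit i = membership of i).

-- bit i of a vector (false outside the range)
bit : ∀ {n} → Vec Bool n → ℕ → Bool
bit []       _       = false
bit (b ∷ v) zero    = b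
bit (b ∷ v) (suc i) = bit v i

card : ∀ {n} → Vec Bool n → ℕ
card []          = 0
card (true ∷ v)  = suc (card v)
card (false ∷ v) = card v

allSubsets : (n : ℕ) → List (Vec Bool n)
allSubsets zero    = [] ∷ []
allSubsets (suc n) = map (true ∷_) (allSubsets n) ++ map (false ∷_) (allSubsets n)

-- S = L ∪ M ∪ R  with  L ⊆ [0,ℓ-1],  M ⊆ [ℓ, r-ℓ-1] (encoded shifted by ℓ),
-- R = R₀ + (r - ℓ) ⊆ [r-ℓ, r-1].
inS : (ℓ r : ℕ) → Vec Bool ℓ → Vec Bool ℓ → Vec Bool (r ∸ (2 * ℓ)) → ℕ → Bool
inS ℓ r L R₀ M x =
  if x <ᵇ ℓ then bit L x
  else if x <ᵇ (r ∸ ℓ) then bit M (x ∸ ℓ)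
  else if x <ᵇ r then bit R₀ (x ∸ (r ∸ ℓ))
  else false

inSumset : (ℕ → Bool) → ℕ → Bool
inSumset S x = any (λ a → S a ∧ S (x ∸ a)) (upTo (suc x))

intervalInSumset : (ℕ → Bool) → ℕ → ℕ → Bool
intervalInSumset S a b = all (λ k → inSumset S (a + k)) (upTo (suc (b ∸ a)))

good : (ℓ r : ℕ) → Vec Bool ℓ → Vec Bool ℓ → Vec Bool (r ∸ (2 * ℓ)) → Bool
good ℓ r L R₀ M = intervalInSumset (inS ℓ r L R₀ M) (2 * ℓ ∸ 1) (2 * r ∸ 2 * ℓ ∸ 1)

inv2^ : ℕ → ℚ
inv2^ k = (+ 1 / (2 ^ k)) {{m^n≢0 2 k}}

prob : (ℓ r : ℕ) → Vec Bool ℓ → Vec Bool ℓ → ℚ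
prob ℓ r L R₀ =
  ((+ length (filter (λ M → T? (good ℓ r L R₀ M)) (allSubsets (r ∸ (2 * ℓ)))))
    / (2 ^ (r ∸ (2 * ℓ)))) {{m^n≢0 2 (r ∸ (2 * ℓ))}}

-- Lemma B.1.  Write m = r - 2ℓ and x k = 2ℓ - 1 + k (k ≤ 2m) for the points
-- of the interval.  By the union bound, P(bad) ≤ Σ_k P(x k ∉ S + S).  For
-- k = h + e + h (e ∈ {0,1}, k + ℓ ≤ m) the sums x k = (ℓ+i) + (ℓ+j) with
-- i + j = k - 1 use h disjoint pairs and e single positions of M, and the
-- sums x k = a + (ℓ + k + q), a ∈ L, use the further positions k + q with
-- q in the reversal of L; these are independent, giving
-- P(x k ∉ S + S) ≤ (3/4)^h 2^-e 2^-|L|.  Reversing M gives the same at the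
-- right end with R₀.  Summed over 2H indices at each end this is at most
-- 6·2^-|L| and 6·2^-|R₀|; each of the O(ℓ) remaining middle indices has
-- probability at most (3/4)^H, which is small once H is large compared to
-- ℓ and the denominator of ε.
module Submission where

open import Data.Bool using (Bool)
open import Data.Nat as ℕ using (ℕ)
open import Data.Vec using (Vec)

module Series where
  open import Data.Nat using (ℕ; zero; suc; _+_; _*_; _^_; _∸_; _≤_; _<_; z≤n; s≤s; _≤?_; NonZero)
  open import Data.Nat.Properties
  open import Data.Product using (∃₂; _×_; _,_)
  open import Relation.Binary.PropositionalEquality
  open import Relation.Nullary using (yes; no; contradiction)
  open import Data.Nat.Tactic.RingSolver using (solve-∀)

  sumTo : ℕ → (ℕ → ℕ) → ℕ
  sumTo zero    f = 0
  sumTo (suc n) f = f 0 + sumTo n (λ i → f (suc i))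

  sumTo-+ : ∀ a b f → sumTo (a + b) f ≡ sumTo a f + sumTo b (λ i → f (a + i))
  sumTo-+ zero    b f = refl
  sumTo-+ (suc a) b f = trans (cong (f 0 +_) (sumTo-+ a b (λ i → f (suc i)))) (sym (+-assoc (f 0) _ _))

  sumTo-last : ∀ n f → sumTo (suc n) f ≡ sumTo n f + f n
  sumTo-last zero    f = +-comm (f 0) 0
  sumTo-last (suc n) f = trans (cong (f 0 +_) (sumTo-last n (λ i → f (suc i)))) (sym (+-assoc (f 0) _ _))

  sumTo-reflect : ∀ n f → sumTo n (λ i → f (n ∸ suc i)) ≡ sumTo n f
  sumTo-reflect zero    f = refl
  sumTo-reflect (suc n) f = trans (cong (f n +_) (sumTo-reflect n f)) (trans (+-comm (f n) _) (sym (sumTo-last n f)))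

  sumTo-bound : ∀ n f q c → (∀ i → i < n → f i * q ≤ c) → sumTo n f * q ≤ n * c
  sumTo-bound zero    f q c _     = z≤n
  sumTo-bound (suc n) f q c bound = begin
      (f 0 + sumTo n (λ i → f (suc i))) * q
    ≡⟨ *-distribʳ-+ q (f 0) _ ⟩
      f 0 * q + sumTo n (λ i → f (suc i)) * q
    ≤⟨ +-mono-≤ (bound 0 (s≤s z≤n))
                (sumTo-bound n (λ i → f (suc i)) q c (λ i i<n → bound (suc i) (s≤s i<n))) ⟩
      c + n * c ∎
    where open ≤-Reasoning

  sumTo-pairs : ∀ H f → sumTo (H + H) f ≡ sumTo H (λ h → f (h + h) + f (h + suc h))
  sumTo-pairs zero    f = refl
  sumTo-pairs (suc H) f = begin
      sumTo (suc H + suc H) f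
    ≡⟨ cong (λ n → sumTo n f) (double-suc H) ⟩
      sumTo (H + H + 2) f
    ≡⟨ sumTo-+ (H + H) 2 f ⟩
      sumTo (H + H) f + (f (H + H + 0) + (f (H + H + 1) + 0))
    ≡⟨ cong₂ (λ a b → sumTo (H + H) f + (f a + b)) (+-identityʳ (H + H))
         (trans (+-identityʳ _) (cong f (trans (+-comm (H + H) 1) (sym (+-suc H H))))) ⟩
      sumTo (H + H) f + (f (H + H) + f (H + suc H))
    ≡⟨ cong (_+ (f (H + H) + f (H + suc H))) (sumTo-pairs H f) ⟩
      sumTo H (λ h → f (h + h) + f (h + suc h)) + (f (H + H) + f (H + suc H))
    ≡⟨ sym (sumTo-last H (λ h → f (h + h) + f (h + suc h))) ⟩
      sumTo (suc H) (λ h → f (h + h) + f (h + suc h)) ∎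
    where
    open ≡-Reasoning
    double-suc : ∀ H → suc H + suc H ≡ H + H + 2
    double-suc = solve-∀

  -- Geometric series with ratio 3/4: if g h ≤ c (3/4)^h (after scaling by
  -- w) then the partial sums of g, scaled by w, stay below 4c.  The
  -- invariant carries the exact remainder 4c (3/4)^H.
  geometric-invariant : ∀ H g w c → (∀ h → h < H → g h * w * 4 ^ h ≤ c * 3 ^ h) →
    sumTo H g * w * 4 ^ H + 4 * c * 3 ^ H ≤ 4 * c * 4 ^ H
  geometric-invariant zero    g w c _     = ≤-reflexive (cong (_+ 4 * c * 1) (*-zeroʳ (0 * w)))
  geometric-invariant (suc H) g w c bound = begin
      sumTo (suc H) g * w * 4 ^ suc H + 4 * c * 3 ^ suc H
    ≡⟨ cong (λ s → s * w * 4 ^ suc H + 4 * c * 3 ^ suc H) (sumTo-last H g) ⟩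
      (S + g H) * w * (4 * 4 ^ H) + 4 * c * (3 * 3 ^ H)
    ≡⟨ expand S (g H) w (4 ^ H) c (3 ^ H) ⟩
      4 * (S * w * 4 ^ H) + 4 * (g H * w * 4 ^ H) + 12 * (c * 3 ^ H)
    ≤⟨ +-monoˡ-≤ (12 * (c * 3 ^ H)) (+-monoʳ-≤ (4 * (S * w * 4 ^ H)) (*-monoʳ-≤ 4 (bound H ≤-refl))) ⟩
      4 * (S * w * 4 ^ H) + 4 * (c * 3 ^ H) + 12 * (c * 3 ^ H)
    ≡⟨ collect (S * w * 4 ^ H) (c * 3 ^ H) ⟩
      4 * (S * w * 4 ^ H + 4 * (c * 3 ^ H))
    ≡⟨ cong (λ z → 4 * (S * w * 4 ^ H + z)) (sym (*-assoc 4 c (3 ^ H))) ⟩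
      4 * (S * w * 4 ^ H + 4 * c * 3 ^ H)
    ≤⟨ *-monoʳ-≤ 4 (geometric-invariant H g w c (λ h h<H → bound h (m≤n⇒m≤1+n h<H))) ⟩
      4 * (4 * c * 4 ^ H)
    ≡⟨ shift c (4 ^ H) ⟩
      4 * c * 4 ^ suc H ∎
    where
    open ≤-Reasoning
    S : ℕ
    S = sumTo H g
    expand : ∀ S g w q c t → (S + g) * w * (4 * q) + 4 * c * (3 * t) ≡ 4 * (S * w * q) + 4 * (g * w * q) + 12 * (c * t)
    expand = solve-∀
    collect : ∀ a b → 4 * a + 4 * b + 12 * b ≡ 4 * (a + 4 * b)
    collect = solve-∀
    shift : ∀ c q → 4 * (4 * c * q) ≡ 4 * c * (4 * q)
    shift = solve-∀

  geometric : ∀ H g w c → (∀ h → h < H → g h * w * 4 ^ h ≤ c * 3 ^ h) → sumTo H g * w ≤ 4 * c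
  geometric H g w c bound = *-cancelʳ-≤ (sumTo H g * w) (4 * c) (4 ^ H) {{m^n≢0 4 H}}
    (≤-trans (m≤m+n _ (4 * c * 3 ^ H)) (geometric-invariant H g w c bound))

  2^-double : ∀ h → 2 ^ (h + h) ≡ 4 ^ h
  2^-double zero    = refl
  2^-double (suc h) = begin
      2 * 2 ^ (h + suc h)   ≡⟨ cong (λ z → 2 * 2 ^ z) (+-suc h h) ⟩
      2 * (2 * 2 ^ (h + h)) ≡⟨ sym (*-assoc 2 2 (2 ^ (h + h))) ⟩
      4 * 2 ^ (h + h)       ≡⟨ cong (4 *_) (2^-double h) ⟩
      4 * 4 ^ h             ∎
    where open ≡-Reasoning

  -- A sequence f with f (2h + e) ≤ (3/4)^h 2^-e P / A for e ∈ {0, 1}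
  -- sums (over its first 2H terms) to at most 6P / A: each pair
  -- contributes at most (3/2)(3/4)^h P / A.
  paired-geometric : ∀ H f A P →
    (∀ h e → e ≤ 1 → h < H → f (h + (e + h)) * A * 2 ^ (h + (e + h)) ≤ 3 ^ h * P) →
    sumTo (H + H) f * A ≤ 6 * P
  paired-geometric H f A P bound = *-cancelˡ-≤ 2 (begin
      2 * (sumTo (H + H) f * A)
    ≡⟨ cong (λ s → 2 * (s * A)) (sumTo-pairs H f) ⟩
      2 * (sumTo H g * A)
    ≡⟨ sym (swap-2 (sumTo H g) A) ⟩
      sumTo H g * (A * 2)
    ≤⟨ geometric H g (A * 2) (3 * P) pair-bound ⟩
      4 * (3 * P)
    ≡⟨ twelve P ⟩
      2 * (6 * P) ∎)
    where
    open ≤-Reasoning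
    g : ℕ → ℕ
    g h = f (h + h) + f (h + suc h)
    pair-bound : ∀ h → h < H → g h * (A * 2) * 4 ^ h ≤ 3 * P * 3 ^ h
    pair-bound h h<H = begin
        g h * (A * 2) * 4 ^ h
      ≡⟨ split-pair (f (h + h)) (f (h + suc h)) A (4 ^ h) ⟩
        2 * (f (h + h) * A * 4 ^ h) + f (h + suc h) * A * (2 * 4 ^ h)
      ≡⟨ cong₂ (λ a b → 2 * (f (h + h) * A * a) + f (h + suc h) * A * b)
           (sym (2^-double h)) (sym (trans (cong (2 ^_) (+-suc h h)) (cong (2 *_) (2^-double h)))) ⟩
        2 * (f (h + h) * A * 2 ^ (h + h)) + f (h + suc h) * A * 2 ^ (h + suc h)
      ≤⟨ +-mono-≤ (*-monoʳ-≤ 2 (bound h 0 z≤n h<H)) (bound h 1 (s≤s z≤n) h<H) ⟩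
        2 * (3 ^ h * P) + 3 ^ h * P
      ≡⟨ three-halves (3 ^ h) P ⟩
        3 * P * 3 ^ h ∎
      where
      split-pair : ∀ a b A q → (a + b) * (A * 2) * q ≡ 2 * (a * A * q) + b * A * (2 * q)
      split-pair = solve-∀
      three-halves : ∀ t P → 2 * (t * P) + t * P ≡ 3 * P * t
      three-halves = solve-∀
    swap-2 : ∀ s A → s * (A * 2) ≡ 2 * (s * A)
    swap-2 = solve-∀
    twelve : ∀ P → 4 * (3 * P) ≡ 2 * (6 * P)
    twelve = solve-∀

  halve : ∀ k → ∃₂ λ h e → e ≤ 1 × h + (e + h) ≡ k
  halve zero = 0 , 0 , z≤n , refl
  halve (suc k) with halve k
  ... | h , zero     , _       , eq = h , 1 , s≤s z≤n , trans (+-suc h h) (cong suc eq)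
  ... | h , suc zero , _       , eq = suc h , 0 , z≤n , cong suc eq
  ... | h , suc (suc e) , s≤s () , _

  half-≤ : ∀ a h e → e ≤ 1 → a + a ≤ h + (e + h) → a ≤ h
  half-≤ a h e e≤1 le with a ≤? h
  ... | yes a≤h = a≤h
  ... | no  a≰h = contradiction le (<⇒≱ (begin-strict
        h + (e + h)     ≤⟨ +-monoʳ-≤ h (+-monoˡ-≤ h e≤1) ⟩
        h + suc h       <⟨ +-monoˡ-< (suc h) (n<1+n h) ⟩
        suc h + suc h   ≤⟨ +-mono-≤ (≰⇒> a≰h) (≰⇒> a≰h) ⟩
        a + a           ∎))
    where open ≤-Reasoning

  decay : ∀ H h e → H ≤ h → 3 ^ h * 4 ^ H ≤ 3 ^ H * 2 ^ (h + (e + h))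
  decay H h e H≤h = begin
      3 ^ h * 4 ^ H              ≡⟨ cong (λ z → 3 ^ z * 4 ^ H) (sym (m∸n+n≡m H≤h)) ⟩
      3 ^ (d + H) * 4 ^ H        ≤⟨ ratio d ⟩
      3 ^ H * 4 ^ (d + H)        ≡⟨ cong (λ z → 3 ^ H * 4 ^ z) (m∸n+n≡m H≤h) ⟩
      3 ^ H * 4 ^ h              ≡⟨ cong (3 ^ H *_) (sym (2^-double h)) ⟩
      3 ^ H * 2 ^ (h + h)        ≤⟨ *-monoʳ-≤ (3 ^ H) (^-monoʳ-≤ 2 (+-monoʳ-≤ h (m≤n+m h e))) ⟩
      3 ^ H * 2 ^ (h + (e + h))  ∎
    where
    open ≤-Reasoning
    d : ℕ
    d = h ∸ H
    left-comm : ∀ a b c → a * (b * c) ≡ b * (a * c)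
    left-comm = solve-∀
    ratio : ∀ d → 3 ^ (d + H) * 4 ^ H ≤ 3 ^ H * 4 ^ (d + H)
    ratio zero    = ≤-refl
    ratio (suc d) = begin
        3 * 3 ^ (d + H) * 4 ^ H    ≡⟨ *-assoc 3 (3 ^ (d + H)) (4 ^ H) ⟩
        3 * (3 ^ (d + H) * 4 ^ H)  ≤⟨ *-monoʳ-≤ 3 (ratio d) ⟩
        3 * (3 ^ H * 4 ^ (d + H))  ≤⟨ *-monoˡ-≤ (3 ^ H * 4 ^ (d + H)) (n≤1+n 3) ⟩
        4 * (3 ^ H * 4 ^ (d + H))  ≡⟨ left-comm 4 (3 ^ H) (4 ^ (d + H)) ⟩
        3 ^ H * (4 * 4 ^ (d + H))  ∎

  grow : ∀ H → (H + 3) * 3 ^ H ≤ 3 * 4 ^ H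
  grow zero    = ≤-refl
  grow (suc H) = begin
      (suc H + 3) * (3 * 3 ^ H)                 ≡⟨ unfold H (3 ^ H) ⟩
      3 * ((H + 3) * 3 ^ H) + 3 * 3 ^ H         ≤⟨ +-monoʳ-≤ _ (*-monoˡ-≤ (3 ^ H) (m≤n+m 3 H)) ⟩
      3 * ((H + 3) * 3 ^ H) + (H + 3) * 3 ^ H   ≡⟨ collect ((H + 3) * 3 ^ H) ⟩
      4 * ((H + 3) * 3 ^ H)                     ≤⟨ *-monoʳ-≤ 4 (grow H) ⟩
      4 * (3 * 4 ^ H)                           ≡⟨ four-three (4 ^ H) ⟩
      3 * (4 * 4 ^ H)                           ∎
    where
    open ≤-Reasoning
    unfold : ∀ H t → (suc H + 3) * (3 * t) ≡ 3 * ((H + 3) * t) + 3 * t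
    unfold = solve-∀
    collect : ∀ a → 3 * a + a ≡ 4 * a
    collect = solve-∀
    four-three : ∀ a → 4 * (3 * a) ≡ 3 * (4 * a)
    four-three = solve-∀

  trade : ∀ b w t Q T c → b * w ≤ t * c → t * Q ≤ T * w → .{{_ : NonZero w}} → b * Q ≤ T * c
  trade b w t Q T c bw tQ = *-cancelʳ-≤ (b * Q) (T * c) w (begin
      b * Q * w    ≡⟨ swap b Q w ⟩
      b * w * Q    ≤⟨ *-monoˡ-≤ Q bw ⟩
      t * c * Q    ≡⟨ swap t c Q ⟩
      t * Q * c    ≤⟨ *-monoˡ-≤ c tQ ⟩
      T * w * c    ≡⟨ swap T w c ⟩
      T * c * w    ∎)
    where
    open ≤-Reasoning
    swap : ∀ a b c → a * b * c ≡ a * c * b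
    swap = solve-∀

module Counting where
  open import Defs using (allSubsets)
  open import Data.Bool using (Bool; true; false; _∧_; _∨_; not; if_then_else_; T; T?)
  open import Relation.Nullary using (Dec)
  open import Data.Nat using (ℕ; zero; suc; _+_; _*_; _^_; _≤_; z≤n; s≤s)
  open import Data.Nat.Properties
  open import Data.Vec using (Vec; []; _∷_; _∷ʳ_; take; drop; reverse)
  open import Data.Vec.Properties using (reverse-∷)
  open import Data.List using (List; map; _++_; length; filter; applyUpTo)
  open import Data.Bool.ListAction using (all)
  open Series using (sumTo)
  open import Data.List.Properties using (length-++; filter-++)
  open import Relation.Binary.PropositionalEquality
  open import Data.Nat.Tactic.RingSolver using (solve-∀)

  count : ∀ {n} → (Vec Bool n → Bool) → ℕ
  count {zero}  f = if f [] then 1 else 0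
  count {suc n} f = count (λ v → f (true ∷ v)) + count (λ v → f (false ∷ v))

  length-filter-map : ∀ {A B : Set} (P : B → Bool) (g : A → B) (xs : List A) →
    length (filter (λ y → T? (P y)) (map g xs)) ≡ length (filter (λ x → T? (P (g x))) xs)
  length-filter-map P g Data.List.[] = refl
  length-filter-map P g (x Data.List.∷ xs) with P (g x)
  ... | true  = cong suc (length-filter-map P g xs)
  ... | false = length-filter-map P g xs

  count-allSubsets : ∀ n (f : Vec Bool n → Bool) →
    length (filter (λ v → T? (f v)) (allSubsets n)) ≡ count f
  count-allSubsets zero f with f []
  ... | true  = refl
  ... | false = refl
  count-allSubsets (suc n) f = begin
      length (filter P (map (true ∷_) vs ++ map (false ∷_) vs))
    ≡⟨ cong length (filter-++ P (map (true ∷_) vs) (map (false ∷_) vs)) ⟩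
      length (filter P (map (true ∷_) vs) ++ filter P (map (false ∷_) vs))
    ≡⟨ length-++ (filter P (map (true ∷_) vs)) ⟩
      length (filter P (map (true ∷_) vs)) + length (filter P (map (false ∷_) vs))
    ≡⟨ cong₂ _+_ (trans (length-filter-map f (true ∷_) vs) (count-allSubsets n _))
                 (trans (length-filter-map f (false ∷_) vs) (count-allSubsets n _)) ⟩
      count f ∎
    where
    open ≡-Reasoning
    vs : List (Vec Bool n)
    vs = allSubsets n
    P : (v : Vec Bool (suc n)) → Dec (T (f v))
    P v = T? (f v)

  count-ext : ∀ {n} {f g : Vec Bool n → Bool} → (∀ v → f v ≡ g v) → count f ≡ count g
  count-ext {zero}  f≗g rewrite f≗g [] = refl
  count-ext {suc n} f≗g = cong₂ _+_ (count-ext (λ v → f≗g (true ∷ v))) (count-ext (λ v → f≗g (false ∷ v)))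

  count-mono : ∀ {n} {f g : Vec Bool n → Bool} → (∀ v → f v ≡ true → g v ≡ true) → count f ≤ count g
  count-mono {zero} {f} {g} f⇒g with f [] | g [] | f⇒g []
  ... | false | _     | _  = z≤n
  ... | true  | true  | _  = ≤-refl
  ... | true  | false | fg with fg refl
  ...   | ()
  count-mono {suc n} f⇒g = +-mono-≤ (count-mono (λ v → f⇒g (true ∷ v))) (count-mono (λ v → f⇒g (false ∷ v)))

  count-∨ : ∀ {n} (f g : Vec Bool n → Bool) → count (λ v → f v ∨ g v) ≤ count f + count g
  count-∨ {zero} f g with f [] | g []
  ... | true  | true  = s≤s z≤n
  ... | true  | false = ≤-refl
  ... | false | _     = ≤-refl
  count-∨ {suc n} f g = begin
      count (λ v → f (true ∷ v) ∨ g (true ∷ v)) + count (λ v → f (false ∷ v) ∨ g (false ∷ v))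
    ≤⟨ +-mono-≤ (count-∨ (λ v → f (true ∷ v)) (λ v → g (true ∷ v)))
                (count-∨ (λ v → f (false ∷ v)) (λ v → g (false ∷ v))) ⟩
      (count (λ v → f (true ∷ v)) + count (λ v → g (true ∷ v)))
        + (count (λ v → f (false ∷ v)) + count (λ v → g (false ∷ v)))
    ≡⟨ interchange (count (λ v → f (true ∷ v))) _ _ _ ⟩
      count f + count g ∎
    where
    open ≤-Reasoning
    interchange : ∀ a b c d → (a + b) + (c + d) ≡ (a + c) + (b + d)
    interchange = solve-∀

  count-false : ∀ n → count {n} (λ _ → false) ≡ 0
  count-false zero    = refl
  count-false (suc n) = cong₂ _+_ (count-false n) (count-false n)

  count-true : ∀ n → count {n} (λ _ → true) ≡ 2 ^ n
  count-true zero    = refl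
  count-true (suc n) = cong₂ _+_ (count-true n) (trans (count-true n) (sym (+-identityʳ (2 ^ n))))

  count-not : ∀ {n} (f : Vec Bool n → Bool) → count f + count (λ v → not (f v)) ≡ 2 ^ n
  count-not {zero} f with f []
  ... | true  = refl
  ... | false = refl
  count-not {suc n} f = begin
      (a + b) + (c + d)  ≡⟨ interchange a b c d ⟩
      (a + c) + (b + d)  ≡⟨ cong₂ _+_ (count-not (λ v → f (true ∷ v))) (count-not (λ v → f (false ∷ v))) ⟩
      2 ^ n + 2 ^ n      ≡⟨ cong (2 ^ n +_) (sym (+-identityʳ (2 ^ n))) ⟩
      2 ^ suc n          ∎
    where
    open ≡-Reasoning
    a b c d : ℕ
    a = count (λ v → f (true ∷ v))
    b = count (λ v → f (false ∷ v))
    c = count (λ v → not (f (true ∷ v)))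
    d = count (λ v → not (f (false ∷ v)))
    interchange : ∀ a b c d → (a + b) + (c + d) ≡ (a + c) + (b + d)
    interchange = solve-∀

  count-product : ∀ a {b} (f : Vec Bool a → Bool) (g : Vec Bool b → Bool) →
    count (λ v → f (take a v) ∧ g (drop a v)) ≡ count f * count g
  count-product zero {b} f g with f []
  ... | true  = sym (+-identityʳ (count g))
  ... | false = count-false b
  count-product (suc a) f g = begin
      count (λ v → f (true ∷ take a v) ∧ g (drop a v)) + count (λ v → f (false ∷ take a v) ∧ g (drop a v))
    ≡⟨ cong₂ _+_ (count-product a (λ u → f (true ∷ u)) g) (count-product a (λ u → f (false ∷ u)) g) ⟩
      count (λ u → f (true ∷ u)) * count g + count (λ u → f (false ∷ u)) * count g
    ≡⟨ sym (*-distribʳ-+ (count g) (count (λ u → f (true ∷ u))) _) ⟩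
      count f * count g ∎
    where open ≡-Reasoning

  sumAll : ∀ {n} → (Vec Bool n → ℕ) → ℕ
  sumAll {zero}  φ = φ []
  sumAll {suc n} φ = sumAll (λ v → φ (true ∷ v)) + sumAll (λ v → φ (false ∷ v))

  count-sections : ∀ a {b} (F : Vec Bool a → Vec Bool b → Bool) →
    count (λ v → F (take a v) (drop a v)) ≡ sumAll (λ u → count (F u))
  count-sections zero    F = refl
  count-sections (suc a) F =
    cong₂ _+_ (count-sections a (λ u → F (true ∷ u))) (count-sections a (λ u → F (false ∷ u)))

  sumAll-ext : ∀ {n} {φ ψ : Vec Bool n → ℕ} → (∀ v → φ v ≡ ψ v) → sumAll φ ≡ sumAll ψ
  sumAll-ext {zero}  φ≗ψ = φ≗ψ []
  sumAll-ext {suc n} φ≗ψ =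
    cong₂ _+_ (sumAll-ext (λ v → φ≗ψ (true ∷ v))) (sumAll-ext (λ v → φ≗ψ (false ∷ v)))

  sumAll-scale : ∀ {n} k (φ : Vec Bool n → ℕ) → sumAll (λ v → k * φ v) ≡ k * sumAll φ
  sumAll-scale {zero}  k φ = refl
  sumAll-scale {suc n} k φ =
    trans (cong₂ _+_ (sumAll-scale k (λ v → φ (true ∷ v))) (sumAll-scale k (λ v → φ (false ∷ v))))
    (sym (*-distribˡ-+ k (sumAll (λ v → φ (true ∷ v))) _))

  count-∷ʳ : ∀ {n} (f : Vec Bool (suc n) → Bool) →
    count f ≡ count (λ v → f (v ∷ʳ true)) + count (λ v → f (v ∷ʳ false))
  count-∷ʳ {zero}  f = refl
  count-∷ʳ {suc n} f = begin
      count (λ v → f (true ∷ v)) + count (λ v → f (false ∷ v))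
    ≡⟨ cong₂ _+_ (count-∷ʳ (λ v → f (true ∷ v))) (count-∷ʳ (λ v → f (false ∷ v))) ⟩
      (a + b) + (c + d)
    ≡⟨ interchange a b c d ⟩
      (a + c) + (b + d) ∎
    where
    open ≡-Reasoning
    a b c d : ℕ
    a = count (λ v → f (true ∷ (v ∷ʳ true)))
    b = count (λ v → f (true ∷ (v ∷ʳ false)))
    c = count (λ v → f (false ∷ (v ∷ʳ true)))
    d = count (λ v → f (false ∷ (v ∷ʳ false)))
    interchange : ∀ a b c d → (a + b) + (c + d) ≡ (a + c) + (b + d)
    interchange = solve-∀

  count-reverse : ∀ {n} (f : Vec Bool n → Bool) → count (λ v → f (reverse v)) ≡ count f
  count-reverse {zero}  f = refl
  count-reverse {suc n} f = begin
      count (λ v → f (reverse (true ∷ v))) + count (λ v → f (reverse (false ∷ v)))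
    ≡⟨ cong₂ _+_ (count-ext (λ v → cong f (reverse-∷ true v)))
                 (count-ext (λ v → cong f (reverse-∷ false v))) ⟩
      count (λ v → f (reverse v ∷ʳ true)) + count (λ v → f (reverse v ∷ʳ false))
    ≡⟨ cong₂ _+_ (count-reverse (λ v → f (v ∷ʳ true))) (count-reverse (λ v → f (v ∷ʳ false))) ⟩
      count (λ v → f (v ∷ʳ true)) + count (λ v → f (v ∷ʳ false))
    ≡⟨ sym (count-∷ʳ f) ⟩
      count f ∎
    where open ≡-Reasoning

  count-not-all : ∀ {n} (P : ℕ → Vec Bool n → Bool) (f : ℕ → ℕ) N →
    count (λ v → not (all (λ k → P k v) (applyUpTo f N))) ≤ sumTo N (λ i → count (λ v → not (P (f i) v)))
  count-not-all {n} P f zero    = ≤-reflexive (count-false n)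
  count-not-all {n} P f (suc N) = begin
      count (λ v → not (P (f 0) v ∧ rest v))
    ≡⟨ count-ext (λ v → de-Morgan (P (f 0) v) (rest v)) ⟩
      count (λ v → not (P (f 0) v) ∨ not (rest v))
    ≤⟨ count-∨ (λ v → not (P (f 0) v)) (λ v → not (rest v)) ⟩
      count (λ v → not (P (f 0) v)) + count (λ v → not (rest v))
    ≤⟨ +-monoʳ-≤ (count (λ v → not (P (f 0) v))) (count-not-all P (λ i → f (suc i)) N) ⟩
      sumTo (suc N) (λ i → count (λ v → not (P (f i) v))) ∎
    where
    open ≤-Reasoning
    rest : Vec Bool n → Bool
    rest v = all (λ k → P k v) (applyUpTo (λ i → f (suc i)) N)
    de-Morgan : ∀ a b → not (a ∧ b) ≡ not a ∨ not b
    de-Morgan true  b = refl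
    de-Morgan false b = refl

module BitVectors where
  open Counting
  open import Defs using (bit; card)
  open import Data.Bool using (Bool; true; false; _∧_; not)
  open import Data.Bool.Properties using (∧-sel; ∧-identityʳ)
  open import Data.Nat using (ℕ; zero; suc; _+_; _*_; _^_; _≤_; _<_; z≤n; s≤s)
  open import Data.Nat.Properties
  open import Data.Vec using (Vec; []; _∷_; _∷ʳ_; take; drop; reverse)
  open import Data.Vec.Properties using (reverse-∷)
  open import Data.Product using (∃; _×_; _,_)
  open import Data.Sum using (_⊎_)
  import Data.Sum as Sum
  open import Relation.Binary.PropositionalEquality
  open import Data.Nat.Tactic.RingSolver using (solve-∀)

  ∧-false : ∀ a b → a ∧ b ≡ false → a ≡ false ⊎ b ≡ false
  ∧-false a b ab = Sum.map (λ e → trans (sym e) ab) (λ e → trans (sym e) ab) (∧-sel a b)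

  bit-true⇒< : ∀ {n} (v : Vec Bool n) i → bit v i ≡ true → i < n
  bit-true⇒< (b ∷ v) zero    _  = s≤s z≤n
  bit-true⇒< (b ∷ v) (suc i) bi = s≤s (bit-true⇒< v i bi)

  bit-take : ∀ a {b} (v : Vec Bool (a + b)) i → i < a → bit (take a v) i ≡ bit v i
  bit-take (suc a) (x ∷ v) zero    _         = refl
  bit-take (suc a) (x ∷ v) (suc i) (s≤s i<a) = bit-take a v i i<a

  bit-drop : ∀ a {b} (v : Vec Bool (a + b)) i → bit (drop a v) i ≡ bit v (a + i)
  bit-drop zero    v       i = refl
  bit-drop (suc a) (x ∷ v) i = bit-drop a v i

  bit-∷ʳ-< : ∀ {n} (v : Vec Bool n) b i → i < n → bit (v ∷ʳ b) i ≡ bit v i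
  bit-∷ʳ-< (x ∷ v) b zero    _         = refl
  bit-∷ʳ-< (x ∷ v) b (suc i) (s≤s i<n) = bit-∷ʳ-< v b i i<n

  bit-∷ʳ-last : ∀ {n} (v : Vec Bool n) b → bit (v ∷ʳ b) n ≡ b
  bit-∷ʳ-last []      b = refl
  bit-∷ʳ-last (x ∷ v) b = bit-∷ʳ-last v b

  bit-reverse : ∀ {n} (v : Vec Bool n) i j → suc (i + j) ≡ n → bit (reverse v) i ≡ bit v j
  bit-reverse {suc n} (x ∷ v) i zero    ij rewrite reverse-∷ x v =
    trans (cong (bit (reverse v ∷ʳ x)) (trans (sym (+-identityʳ i)) (suc-injective ij))) (bit-∷ʳ-last (reverse v) x)
  bit-reverse {suc n} (x ∷ v) i (suc j) ij rewrite reverse-∷ x v =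
    trans (bit-∷ʳ-< (reverse v) x i (subst (i <_) ij′ (s≤s (m≤m+n i j)))) (bit-reverse v i j ij′)
    where
    ij′ : suc (i + j) ≡ n
    ij′ = trans (sym (+-suc i j)) (suc-injective ij)

  card-∷ʳ : ∀ {n} (v : Vec Bool n) b → card (v ∷ʳ b) ≡ card (b ∷ [])  + card v
  card-∷ʳ []          b     = sym (+-identityʳ (card (b ∷ [])))
  card-∷ʳ (true ∷ v)  b     = trans (cong suc (card-∷ʳ v b)) (sym (+-suc (card (b ∷ [])) (card v)))
  card-∷ʳ (false ∷ v) b     = card-∷ʳ v b

  card-reverse : ∀ {n} (v : Vec Bool n) → card (reverse v) ≡ card v
  card-reverse []      = refl
  card-reverse (x ∷ v) rewrite reverse-∷ x v = trans (card-∷ʳ (reverse v) x) (lemma x)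
    where
    lemma : ∀ x → card (x ∷ []) + card (reverse v) ≡ card (x ∷ v)
    lemma true  = cong suc (card-reverse v)
    lemma false = card-reverse v

  isEmpty : ∀ {n} → Vec Bool n → Bool
  isEmpty []      = true
  isEmpty (b ∷ v) = not b ∧ isEmpty v

  disjoint : ∀ {n} → Vec Bool n → Vec Bool n → Bool
  disjoint []       []       = true
  disjoint (c ∷ cs) (w ∷ ws) = not (c ∧ w) ∧ disjoint cs ws

  disjoint-false : ∀ {n} (c w : Vec Bool n) → disjoint c w ≡ false →
    ∃ λ i → bit c i ≡ true × bit w i ≡ true
  disjoint-false (true ∷ c)  (true ∷ w)  _ = zero , refl , refl
  disjoint-false (true ∷ c)  (false ∷ w) e with disjoint-false c w e
  ... | i , ci , wi = suc i , ci , wi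
  disjoint-false (false ∷ c) (x ∷ w)     e with disjoint-false c w e
  ... | i , ci , wi = suc i , ci , wi
  disjoint-false []          []          ()

  count-isEmpty : ∀ n → count {n} isEmpty ≡ 1
  count-isEmpty zero    = refl
  count-isEmpty (suc n) = trans (cong (_+ count {n} isEmpty) (count-false n)) (count-isEmpty n)

  -- A vector avoiding a fixed set c is free outside c: (1/2)^|c| of all.
  count-disjoint : ∀ {n} (c : Vec Bool n) → count (disjoint c) * 2 ^ card c ≡ 2 ^ n
  count-disjoint [] = refl
  count-disjoint {suc n} (true ∷ c) = begin
      (count {n} (λ _ → false) + count (disjoint c)) * (2 * 2 ^ card c)
    ≡⟨ cong (λ z → (z + count (disjoint c)) * (2 * 2 ^ card c)) (count-false n) ⟩
      count (disjoint c) * (2 * 2 ^ card c)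
    ≡⟨ *-comm (count (disjoint c)) _ ⟩
      2 * 2 ^ card c * count (disjoint c)
    ≡⟨ *-assoc 2 (2 ^ card c) _ ⟩
      2 * (2 ^ card c * count (disjoint c))
    ≡⟨ cong (2 *_) (trans (*-comm (2 ^ card c) _) (count-disjoint c)) ⟩
      2 * 2 ^ n ∎
    where open ≡-Reasoning
  count-disjoint {suc n} (false ∷ c) = begin
      (count (disjoint c) + count (disjoint c)) * 2 ^ card c
    ≡⟨ *-distribʳ-+ (2 ^ card c) (count (disjoint c)) _ ⟩
      count (disjoint c) * 2 ^ card c + count (disjoint c) * 2 ^ card c
    ≡⟨ cong₂ _+_ (count-disjoint c) (trans (count-disjoint c) (sym (+-identityʳ (2 ^ n)))) ⟩
      2 ^ suc n ∎
    where open ≡-Reasoning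

  count-disjoint-reverse : ∀ {n} (u : Vec Bool n) → count (disjoint (reverse u)) ≡ count (disjoint u)
  count-disjoint-reverse {n} u = *-cancelʳ-≡ _ _ (2 ^ card u) {{m^n≢0 2 (card u)}} (begin
      count (disjoint (reverse u)) * 2 ^ card u
    ≡⟨ cong (λ z → count (disjoint (reverse u)) * 2 ^ z) (sym (card-reverse u)) ⟩
      count (disjoint (reverse u)) * 2 ^ card (reverse u)
    ≡⟨ count-disjoint (reverse u) ⟩
      2 ^ n
    ≡⟨ sym (count-disjoint u) ⟩
      count (disjoint u) * 2 ^ card u ∎)
    where open ≡-Reasoning

  -- Pairs (u, w) of disjoint subsets of an n-set: each point lies in u,
  -- in w or in neither, so there are 3^n of them.
  sumAll-disjoint : ∀ n → sumAll {n} (λ u → count (disjoint u)) ≡ 3 ^ n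
  sumAll-disjoint zero    = refl
  sumAll-disjoint (suc n) = begin
      sumAll (λ u → count {n} (λ _ → false) + D u) + sumAll (λ u → D u + D u)
    ≡⟨ cong₂ _+_ (sumAll-ext (λ u → cong (_+ D u) (count-false n)))
                 (sumAll-ext (λ u → cong (D u +_) (sym (+-identityʳ (D u))))) ⟩
      sumAll D + sumAll (λ u → 2 * D u)
    ≡⟨ cong (sumAll D +_) (sumAll-scale 2 D) ⟩
      sumAll D + 2 * sumAll D
    ≡⟨ cong (λ z → z + 2 * z) (sumAll-disjoint n) ⟩
      3 ^ n + 2 * 3 ^ n
    ≡⟨ triple (3 ^ n) ⟩
      3 ^ suc n ∎
    where
    open ≡-Reasoning
    D : Vec Bool n → ℕ
    D u = count (disjoint u)
    triple : ∀ a → a + 2 * a ≡ 3 * a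
    triple = solve-∀

  count-take : ∀ a {b} (f : Vec Bool a → Bool) → count (λ v → f (take a {b} v)) ≡ count f * 2 ^ b
  count-take a {b} f = begin
      count (λ v → f (take a v))
    ≡⟨ count-ext (λ v → sym (∧-identityʳ (f (take a v)))) ⟩
      count (λ v → f (take a v) ∧ true)
    ≡⟨ count-product a f (λ _ → true) ⟩
      count f * count {b} (λ _ → true)
    ≡⟨ cong (count f *_) (count-true b) ⟩
      count f * 2 ^ b ∎
    where open ≡-Reasoning

module Window where
  open Counting
  open BitVectors
  open import Defs using (bit; card)
  open import Data.Bool using (Bool; true; false; _∧_)
  open import Data.Nat using (ℕ; zero; suc; _+_; _*_; _^_; _≤_; _<_; s≤s)
  open import Data.Nat.Properties
  open import Data.Vec using (Vec; _∷_; take; drop; reverse)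
  open import Data.Product using (∃; ∃₂; _×_; _,_)
  open import Data.Sum using (_⊎_; inj₁; inj₂)
  open import Relation.Binary.PropositionalEquality
  open import Data.Nat.Tactic.RingSolver using (solve-∀)

  blocks : ∀ h e q → h + (e + h) + q ≡ h + (e + (h + q))
  blocks = solve-∀

  -- The event `Avoids h e t c` on h + e + h + p + t bits, read as blocks
  -- u | z | w | y | free of lengths h, e, h, p, t: the middle block z is
  -- empty, w is disjoint from the reversal of u (so no two positions with
  -- sum h + e + h - 1 are both set), and y is disjoint from c.  `shielded`
  -- is the condition on the blocks after u, for a given u.
  shielded : ∀ h e t {p} (c : Vec Bool p) → Vec Bool h → Vec Bool (e + (h + (p + t))) → Bool
  shielded h e t {p} c u v =
    isEmpty (take e v) ∧ (disjoint (reverse u) (take h w) ∧ disjoint c (take p (drop h w)))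
    where
    w : Vec Bool (h + (p + t))
    w = drop e v

  Avoids : ∀ h e t {p} (c : Vec Bool p) → Vec Bool (h + (e + (h + (p + t)))) → Bool
  Avoids h e t c v = shielded h e t c (take h v) (drop h v)

  -- The blocks are independent; u, w contribute 3^h choices, z one choice,
  -- y a fraction 2^-|c| of its 2^p choices, and the free block 2^t.
  count-Avoids : ∀ h e t {p} (c : Vec Bool p) →
    count (Avoids h e t c) * 2 ^ card c * 2 ^ (h + (e + h)) ≡ 3 ^ h * 2 ^ (h + (e + (h + (p + t))))
  count-Avoids h e t {p} c = begin
      count (Avoids h e t c) * 2 ^ card c * 2 ^ k
    ≡⟨ cong (λ z → z * 2 ^ card c * 2 ^ k) count-sum ⟩
      K * 3 ^ h * 2 ^ card c * 2 ^ k
    ≡⟨ regroup (count (disjoint c)) (2 ^ t) (3 ^ h) (2 ^ card c) (2 ^ k) ⟩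
      3 ^ h * (2 ^ k * ((count (disjoint c) * 2 ^ card c) * 2 ^ t))
    ≡⟨ cong (λ z → 3 ^ h * (2 ^ k * (z * 2 ^ t))) (count-disjoint c) ⟩
      3 ^ h * (2 ^ k * (2 ^ p * 2 ^ t))
    ≡⟨ cong (3 ^ h *_) (trans (cong (2 ^ k *_) (sym (^-distribˡ-+-* 2 p t))) (sym (^-distribˡ-+-* 2 k (p + t)))) ⟩
      3 ^ h * 2 ^ (k + (p + t))
    ≡⟨ cong (λ z → 3 ^ h * 2 ^ z) (blocks h e (p + t)) ⟩
      3 ^ h * 2 ^ (h + (e + (h + (p + t)))) ∎
    where
    open ≡-Reasoning
    k K : ℕ
    k = h + (e + h)
    K = count (disjoint c) * 2 ^ t
    count-shielded : ∀ u → count (shielded h e t c u) ≡ K * count (disjoint u)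
    count-shielded u = begin
        count (shielded h e t c u)
      ≡⟨ count-product e isEmpty _ ⟩
        count {e} isEmpty * count (λ w → disjoint (reverse u) (take h w) ∧ disjoint c (take p (drop h w)))
      ≡⟨ cong₂ _*_ (count-isEmpty e) (count-product h (disjoint (reverse u)) (λ y → disjoint c (take p y))) ⟩
        1 * (count (disjoint (reverse u)) * count (λ y → disjoint c (take p {t} y)))
      ≡⟨ trans (*-identityˡ _) (cong₂ _*_ (count-disjoint-reverse u) (count-take p (disjoint c))) ⟩
        count (disjoint u) * K
      ≡⟨ *-comm (count (disjoint u)) K ⟩
        K * count (disjoint u) ∎
    count-sum : count (Avoids h e t c) ≡ K * 3 ^ h
    count-sum = begin
        count (Avoids h e t c)
      ≡⟨ count-sections h (shielded h e t c) ⟩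
        sumAll (λ u → count (shielded h e t c u))
      ≡⟨ sumAll-ext count-shielded ⟩
        sumAll (λ (u : Vec Bool h) → K * count (disjoint u))
      ≡⟨ sumAll-scale K (λ (u : Vec Bool h) → count (disjoint u)) ⟩
        K * sumAll {h} (λ u → count (disjoint u))
      ≡⟨ cong (K *_) (sumAll-disjoint h) ⟩
        K * 3 ^ h ∎
    regroup : ∀ x y z a b → x * y * z * a * b ≡ z * (b * ((x * a) * y))
    regroup = solve-∀

  -- The three ways a vector v can fail `Avoids`, each giving set positions
  -- of v: a set middle bit (only possible for e = 1), a set pair
  -- (i, h + e + j) with i + j = h - 1, or a set position of y inside c.
  PairWitness : ∀ {n} → Vec Bool n → ℕ → Set
  PairWitness v k = ∃₂ λ i j → bit v i ≡ true × bit v j ≡ true × suc (i + j) ≡ k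

  Witness : ∀ {n p} → Vec Bool p → Vec Bool n → ℕ → Set
  Witness c v k = PairWitness v k ⊎ (∃ λ q → bit c q ≡ true × bit v (k + q) ≡ true)

  middle-witness : ∀ h e {q} (v : Vec Bool (h + (e + q))) → e ≤ 1 →
    isEmpty (take e (drop h v)) ≡ false → PairWitness v (h + (e + h))
  middle-witness h zero        v _        ()
  middle-witness h (suc zero)  v _        nonEmpty = h + 0 , h + 0 , vh , vh , centre h
    where
    head-set : ∀ {q} (z : Vec Bool (1 + q)) → isEmpty (take 1 z) ≡ false → bit z 0 ≡ true
    head-set (true ∷ z)  _  = refl
    head-set (false ∷ z) ()
    vh : bit v (h + 0) ≡ true
    vh = trans (sym (bit-drop h v 0)) (head-set (drop h v) nonEmpty)
    centre : ∀ h → suc (h + 0 + (h + 0)) ≡ h + (1 + h)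
    centre = solve-∀
  middle-witness h (suc (suc e)) v (s≤s ()) _

  pair-witness : ∀ h e {q} (v : Vec Bool (h + (e + (h + q)))) →
    disjoint (reverse (take h v)) (take h (drop e (drop h v))) ≡ false → PairWitness v (h + (e + h))
  pair-witness h e v clash with disjoint-false (reverse (take h v)) (take h (drop e (drop h v))) clash
  ... | j , uj , wj with m≤n⇒∃[o]m+o≡n (bit-true⇒< (take h (drop e (drop h v))) j wj)
  ...   | k , jk = k , h + (e + j) , vk , vj , pair-sum j k e jk
    where
    vk : bit v k ≡ true
    vk = trans (sym (trans (bit-reverse (take h v) j k jk) (bit-take h v k (subst (k <_) jk (s≤s (m≤n+m k j)))))) uj
    vj : bit v (h + (e + j)) ≡ true
    vj = trans (sym (trans (bit-take h (drop e (drop h v)) j (bit-true⇒< (take h (drop e (drop h v))) j wj))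
                    (trans (bit-drop e (drop h v) j) (bit-drop h v (e + j))))) wj
    pair-sum : ∀ {h} j k e → suc (j + k) ≡ h → suc (k + (h + (e + j))) ≡ h + (e + h)
    pair-sum j k e refl = sum-identity j k e
      where
      sum-identity : ∀ j k e → suc (k + (suc (j + k) + (e + j))) ≡ suc (j + k) + (e + suc (j + k))
      sum-identity = solve-∀

  blocked-witness : ∀ h e t {p} (c : Vec Bool p) (v : Vec Bool (h + (e + (h + (p + t))))) →
    disjoint c (take p (drop h (drop e (drop h v)))) ≡ false →
    ∃ λ q → bit c q ≡ true × bit v (h + (e + h) + q) ≡ true
  blocked-witness h e t {p} c v clash with disjoint-false c (take p (drop h (drop e (drop h v)))) clash
  ... | q , cq , yq = q , cq , trans (sym reading) yq
    where
    reading : bit (take p (drop h (drop e (drop h v)))) q ≡ bit v (h + (e + h) + q)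
    reading = trans (bit-take p (drop h (drop e (drop h v))) q (bit-true⇒< c q cq))
                (trans (bit-drop h (drop e (drop h v)) q)
                  (trans (bit-drop e (drop h v) (h + q))
                    (trans (bit-drop h v (e + (h + q))) (cong (bit v) (sym (blocks h e q))))))

  Avoids-witness : ∀ h e t {p} (c : Vec Bool p) (v : Vec Bool (h + (e + (h + (p + t))))) → e ≤ 1 →
    Avoids h e t c v ≡ false → Witness c v (h + (e + h))
  Avoids-witness h e t c v e≤1 avoid with ∧-false _ _ avoid
  ... | inj₁ nonEmpty = inj₁ (middle-witness h e v e≤1 nonEmpty)
  ... | inj₂ rest with ∧-false _ _ rest
  ...   | inj₁ clash = inj₁ (pair-witness h e v clash)
  ...   | inj₂ clash = inj₂ (blocked-witness h e t c v clash)

  count-within-Avoids : ∀ {n} h e t {p} (c : Vec Bool p) (eq : h + (e + (h + (p + t))) ≡ n)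
    (F : Vec Bool n → Bool) →
    (∀ v → Avoids h e t c v ≡ false → F (subst (Vec Bool) eq v) ≡ false) →
    count F * 2 ^ card c * 2 ^ (h + (e + h)) ≤ 3 ^ h * 2 ^ n
  count-within-Avoids h e t c refl F outside = begin
      count F * 2 ^ card c * 2 ^ (h + (e + h))
    ≤⟨ *-monoˡ-≤ (2 ^ (h + (e + h))) (*-monoˡ-≤ (2 ^ card c) (count-mono inside)) ⟩
      count (Avoids h e t c) * 2 ^ card c * 2 ^ (h + (e + h))
    ≡⟨ count-Avoids h e t c ⟩
      3 ^ h * 2 ^ (h + (e + (h + (_ + t)))) ∎
    where
    open ≤-Reasoning
    inside : ∀ v → F v ≡ true → Avoids h e t c v ≡ true
    inside v Fv with Avoids h e t c v in avoid
    ... | true  = refl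
    ... | false = sym (trans (sym Fv) (outside v avoid))

  bit-subst : ∀ {n n′} (eq : n ≡ n′) (v : Vec Bool n) i → bit (subst (Vec Bool) eq v) i ≡ bit v i
  bit-subst refl v i = refl

module Configuration (ℓ r : ℕ) (L R₀ : Vec Bool ℓ) (ℓ>0 : 0 ℕ.< ℓ) (2ℓ≤r : 2 ℕ.* ℓ ℕ.≤ r) where
  open Counting
  open BitVectors
  open Window
  open Series using (sumTo)
  open import Defs
  open import Data.Bool using (true; false; not; _∧_; T)
  open import Data.Bool.Properties using (T-≡)
  open import Data.Nat using (suc; _+_; _*_; _^_; _∸_; _<_; _≤_; _<ᵇ_; s≤s)
  open import Data.Nat.Properties
  open import Data.Vec using (reverse)
  open import Data.List.Relation.Unary.Any.Properties using (any⁺; applyUpTo⁺)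
  open import Data.Product using (∃; _×_; _,_)
  open import Data.Sum using (inj₁; inj₂)
  open import Function.Bundles using (Equivalence)
  open import Relation.Binary.PropositionalEquality
  open import Data.Nat.Tactic.RingSolver using (solve-∀)

  m : ℕ
  m = r ∸ 2 * ℓ

  r≡ : r ≡ ℓ + (ℓ + m)
  r≡ = trans (sym (m+[n∸m]≡n 2ℓ≤r)) (trans (cong (_+ m) (cong (ℓ +_) (+-identityʳ ℓ))) (+-assoc ℓ ℓ m))

  r∸ℓ≡ : r ∸ ℓ ≡ ℓ + m
  r∸ℓ≡ = trans (cong (_∸ ℓ) r≡) (m+n∸m≡n ℓ (ℓ + m))

  S : Vec Bool m → ℕ → Bool
  S = inS ℓ r L R₀

  <ᵇ-true : ∀ a b → a < b → (a <ᵇ b) ≡ true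
  <ᵇ-true a b a<b = Equivalence.to T-≡ (<⇒<ᵇ a<b)

  <ᵇ-false : ∀ a b → b ≤ a → (a <ᵇ b) ≡ false
  <ᵇ-false a b b≤a with a <ᵇ b in lt
  ... | false = refl
  ... | true  = contradiction-≤ (<ᵇ⇒< a b (Equivalence.from T-≡ lt))
    where
    contradiction-≤ : a < b → true ≡ false
    contradiction-≤ a<b with () ← <⇒≱ a<b b≤a

  r∸ℓ+ℓ≡r : r ∸ ℓ + ℓ ≡ r
  r∸ℓ+ℓ≡r = m∸n+n≡m (≤-trans (m≤m+n ℓ (ℓ + 0)) 2ℓ≤r)

  S-left : ∀ M a → a < ℓ → S M a ≡ bit L a
  S-left M a a<ℓ rewrite <ᵇ-true a ℓ a<ℓ = refl

  S-middle : ∀ M i → i < m → S M (ℓ + i) ≡ bit M i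
  S-middle M i i<m
    rewrite <ᵇ-false (ℓ + i) ℓ (m≤m+n ℓ i)
          | <ᵇ-true (ℓ + i) (r ∸ ℓ) (subst (ℓ + i <_) (sym r∸ℓ≡) (+-monoʳ-< ℓ i<m))
          | m+n∸m≡n ℓ i = refl

  S-right : ∀ M b → b < ℓ → S M (ℓ + m + b) ≡ bit R₀ b
  S-right M b b<ℓ
    rewrite sym r∸ℓ≡
          | <ᵇ-false (r ∸ ℓ + b) ℓ
              (≤-trans (≤-trans (m≤m+n ℓ m) (≤-reflexive (sym r∸ℓ≡))) (m≤m+n (r ∸ ℓ) b))
          | <ᵇ-false (r ∸ ℓ + b) (r ∸ ℓ) (m≤m+n (r ∸ ℓ) b)
          | <ᵇ-true (r ∸ ℓ + b) r (subst (r ∸ ℓ + b <_) r∸ℓ+ℓ≡r (+-monoʳ-< (r ∸ ℓ) b<ℓ))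
          | m+n∸m≡n (r ∸ ℓ) b = refl

  x : ℕ → ℕ
  x k = 2 * ℓ ∸ 1 + k

  -- Since ℓ > 0 the subtraction in 2ℓ - 1 is exact.
  1≤2ℓ : 1 ≤ 2 * ℓ
  1≤2ℓ = ≤-trans ℓ>0 (m≤m+n ℓ (ℓ + 0))

  suc-x : ∀ k → suc (x k) ≡ ℓ + ℓ + k
  suc-x k = cong (_+ k) (trans (suc-∸1 (2 * ℓ) 1≤2ℓ) (cong (ℓ +_) (+-identityʳ ℓ)))
    where
    suc-∸1 : ∀ n → 1 ≤ n → suc (n ∸ 1) ≡ n
    suc-∸1 (suc n) _ = refl

  interval-length : (2 * r ∸ 2 * ℓ ∸ 1) ∸ (2 * ℓ ∸ 1) ≡ m + m
  interval-length = begin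
      (2 * r ∸ 2 * ℓ ∸ 1) ∸ (2 * ℓ ∸ 1)
    ≡⟨ cong (λ z → (z ∸ 2 * ℓ ∸ 1) ∸ (2 * ℓ ∸ 1)) (trans (cong (2 *_) r≡) (double ℓ m)) ⟩
      (2 * ℓ + (2 * ℓ + 2 * m) ∸ 2 * ℓ ∸ 1) ∸ (2 * ℓ ∸ 1)
    ≡⟨ cong (λ z → (z ∸ 1) ∸ (2 * ℓ ∸ 1)) (m+n∸m≡n (2 * ℓ) (2 * ℓ + 2 * m)) ⟩
      (2 * ℓ + 2 * m ∸ 1) ∸ (2 * ℓ ∸ 1)
    ≡⟨ cong (_∸ (2 * ℓ ∸ 1)) (+-∸-comm (2 * m) 1≤2ℓ) ⟩
      (2 * ℓ ∸ 1 + 2 * m) ∸ (2 * ℓ ∸ 1)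
    ≡⟨ m+n∸m≡n (2 * ℓ ∸ 1) (2 * m) ⟩
      2 * m
    ≡⟨ cong (m +_) (+-identityʳ m) ⟩
      m + m ∎
    where
    open ≡-Reasoning
    double : ∀ ℓ m → 2 * (ℓ + (ℓ + m)) ≡ 2 * ℓ + (2 * ℓ + 2 * m)
    double = solve-∀

  Missing : ℕ → Vec Bool m → Bool
  Missing k M = not (inSumset (S M) (x k))

  hit : ∀ M k a b → S M a ≡ true → S M b ≡ true → suc (a + b) ≡ ℓ + ℓ + k → Missing k M ≡ false
  hit M k a b Sa Sb sum = cong not (Equivalence.to T-≡ (any⁺ _ (applyUpTo⁺ (λ z → z) both (s≤s a≤x))))
    where
    a+b≡x : a + b ≡ x k
    a+b≡x = suc-injective (trans sum (sym (suc-x k)))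
    a≤x : a ≤ x k
    a≤x = subst (a ≤_) a+b≡x (m≤m+n a b)
    both : T (S M a ∧ S M (x k ∸ a))
    both = Equivalence.from T-≡ (subst (λ z → (S M a ∧ S M (z ∸ a)) ≡ true) a+b≡x
             (trans (cong (λ z → S M a ∧ S M z) (m+n∸m≡n a b)) (cong₂ _∧_ Sa Sb)))

  count-not-good : count (λ M → not (good ℓ r L R₀ M)) ≤ sumTo (suc (m + m)) (λ k → count (Missing k))
  count-not-good = subst (λ n → count (λ M → not (good ℓ r L R₀ M)) ≤ sumTo (suc n) (λ k → count (Missing k)))
    interval-length
    (count-not-all (λ k M → inSumset (S M) (2 * ℓ ∸ 1 + k)) (λ z → z) (suc ((2 * r ∸ 2 * ℓ ∸ 1) ∸ (2 * ℓ ∸ 1))))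

  pair-sum : ∀ {k} l i j → suc (i + j) ≡ k → suc (l + i + (l + j)) ≡ l + l + k
  pair-sum l i j refl = identity l i j
    where
    identity : ∀ l i j → suc (l + i + (l + j)) ≡ l + l + suc (i + j)
    identity = solve-∀

  left-sum : ∀ {l} k q a → suc (q + a) ≡ l → suc (a + (l + (k + q))) ≡ l + l + k
  left-sum k q a refl = identity k q a
    where
    identity : ∀ k q a → suc (a + (suc (q + a) + (k + q))) ≡ suc (q + a) + suc (q + a) + k
    identity = solve-∀

  mirror-pair : ∀ {m k k′} i i′ j j′ → suc (i + j) ≡ m → suc (i′ + j′) ≡ m → suc (i + i′) ≡ k′ →
    k + k′ ≡ m + m → suc (j + j′) ≡ k
  mirror-pair {k = k} i i′ j j′ refl i′j′ refl kk′ = +-cancelʳ-≡ (suc (i + i′)) (suc (j + j′)) k (begin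
      suc (j + j′) + suc (i + i′)    ≡⟨ regroup i i′ j j′ ⟩
      suc (i + j) + suc (i′ + j′)    ≡⟨ cong (suc (i + j) +_) i′j′ ⟩
      suc (i + j) + suc (i + j)      ≡⟨ sym kk′ ⟩
      k + suc (i + i′)               ∎)
    where
    open ≡-Reasoning
    regroup : ∀ i i′ j j′ → suc (j + j′) + suc (i + i′) ≡ suc (i + j) + suc (i′ + j′)
    regroup = solve-∀

  mirror-sum : ∀ {m k k′} l j q → suc (k′ + q + j) ≡ m → k + k′ ≡ m + m →
    suc (l + j + (l + m + q)) ≡ l + l + k
  mirror-sum {k = k} {k′} l j q refl kk′ = +-cancelʳ-≡ k′ _ (l + l + k) (begin
      suc (l + j + (l + M + q)) + k′  ≡⟨ regroup l j q k′ ⟩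
      l + l + (M + M)                 ≡⟨ cong (l + l +_) (sym kk′) ⟩
      l + l + (k + k′)                ≡⟨ sym (+-assoc (l + l) k k′) ⟩
      l + l + k + k′                  ∎)
    where
    open ≡-Reasoning
    M : ℕ
    M = suc (k′ + q + j)
    regroup : ∀ l j q k′ → suc (l + j + (l + suc (k′ + q + j) + q)) + k′
                           ≡ l + l + (suc (k′ + q + j) + suc (k′ + q + j))
    regroup = solve-∀

  in-window : ∀ {n} (eq : n ≡ m) (v : Vec Bool n) i → bit v i ≡ true →
    S (subst (Vec Bool) eq v) (ℓ + i) ≡ true
  in-window eq v i vi = trans (S-middle M i (bit-true⇒< M i Mi)) Mi
    where
    M : Vec Bool m
    M = subst (Vec Bool) eq v
    Mi : bit M i ≡ true
    Mi = trans (bit-subst eq v i) vi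

  in-mirror : ∀ {n} (eq : n ≡ m) (v : Vec Bool n) i → bit v i ≡ true →
    ∃ λ j → suc (i + j) ≡ m × S (reverse (subst (Vec Bool) eq v)) (ℓ + j) ≡ true
  in-mirror eq v i vi = mirror (subst (Vec Bool) eq v) (trans (bit-subst eq v i) vi)
    where
    mirror : ∀ M → bit M i ≡ true → ∃ λ j → suc (i + j) ≡ m × S (reverse M) (ℓ + j) ≡ true
    mirror M Mi with m≤n⇒∃[o]m+o≡n (bit-true⇒< M i Mi)
    ... | j , ij = j , ij , trans (S-middle (reverse M) j (subst (j <_) ij (s≤s (m≤n+m j i))))
                                  (trans (bit-reverse M j i (trans (cong suc (+-comm j i)) ij)) Mi)

  -- The bound for x k with k = h + e + h in the lower half of the interval:
  -- pairs inside the window, and pairs with L (recorded in c ⊆ reverse L).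
  left-bound : ∀ h e t {p} (c : Vec Bool p) → e ≤ 1 → (eq : h + (e + (h + (p + t))) ≡ m) →
    (∀ q → bit c q ≡ true → bit (reverse L) q ≡ true) →
    count (Missing (h + (e + h))) * 2 ^ card c * 2 ^ (h + (e + h)) ≤ 3 ^ h * 2 ^ m
  left-bound h e t c e≤1 eq c⊆L = count-within-Avoids h e t c eq (Missing k)
    (λ v avoid → hits v (Avoids-witness h e t c v e≤1 avoid))
    where
    k : ℕ
    k = h + (e + h)
    hits : ∀ v → Witness c v k → Missing k (subst (Vec Bool) eq v) ≡ false
    hits v (inj₁ (i , j , vi , vj , ij)) =
      hit (subst (Vec Bool) eq v) k (ℓ + i) (ℓ + j) (in-window eq v i vi) (in-window eq v j vj) (pair-sum ℓ i j ij)
    hits v (inj₂ (q , cq , vq)) with m≤n⇒∃[o]m+o≡n (bit-true⇒< (reverse L) q (c⊆L q cq))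
    ... | a , qa = hit M k a (ℓ + (k + q)) a∈S (in-window eq v (k + q) vq) (left-sum k q a qa)
      where
      M : Vec Bool m
      M = subst (Vec Bool) eq v
      a∈S : S M a ≡ true
      a∈S = trans (S-left M a (subst (a <_) qa (s≤s (m≤n+m a q)))) (trans (sym (bit-reverse L q a qa)) (c⊆L q cq))

  -- The mirror image: x k with k + k′ = 2m and k′ = h + e + h, read through
  -- the reversal of M; pairs with R₀ are recorded in c ⊆ R₀.
  right-bound : ∀ h e t {p} (c : Vec Bool p) k → e ≤ 1 → (eq : h + (e + (h + (p + t))) ≡ m) →
    k + (h + (e + h)) ≡ m + m → (∀ q → bit c q ≡ true → bit R₀ q ≡ true) →
    count (Missing k) * 2 ^ card c * 2 ^ (h + (e + h)) ≤ 3 ^ h * 2 ^ m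
  right-bound h e t c k e≤1 eq kk′ c⊆R =
    subst (λ z → z * 2 ^ card c * 2 ^ (h + (e + h)) ≤ 3 ^ h * 2 ^ m) (count-reverse (Missing k))
      (count-within-Avoids h e t c eq (λ M → Missing k (reverse M))
        (λ v avoid → hits v (Avoids-witness h e t c v e≤1 avoid)))
    where
    hits : ∀ v → Witness c v (h + (e + h)) → Missing k (reverse (subst (Vec Bool) eq v)) ≡ false
    hits v (inj₁ (i , i′ , vi , vi′ , ii′)) with in-mirror eq v i vi | in-mirror eq v i′ vi′
    ... | j , ij , Sj | j′ , i′j′ , Sj′ = hit (reverse (subst (Vec Bool) eq v)) k (ℓ + j) (ℓ + j′) Sj Sj′
                                            (pair-sum ℓ j j′ (mirror-pair i i′ j j′ ij i′j′ ii′ kk′))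
    hits v (inj₂ (q , cq , vq)) with in-mirror eq v (h + (e + h) + q) vq
    ... | j , ij , Sj = hit M k (ℓ + j) (ℓ + m + q) Sj (trans (S-right M q (bit-true⇒< R₀ q Rq)) Rq)
                            (mirror-sum ℓ j q ij kk′)
      where
      M : Vec Bool m
      M = reverse (subst (Vec Bool) eq v)
      Rq : bit R₀ q ≡ true
      Rq = c⊆R q cq

  -- With m - ℓ = H + s + H (s ≤ 1), the 2m + 1 indices k of the interval
  -- split into a left tail k < 2H, a middle block of Mc = 2(ℓ + s) + 1
  -- indices, and a right tail of 2H indices.
  module IntervalSplit (H s : ℕ) (s≤1 : s ≤ 1) (m-split : H + (s + H) + ℓ ≡ m) where
    open Series
    open import Data.Nat using (NonZero)
    open import Data.Vec using ([])
    open import Relation.Nullary using (yes; no)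

    B : ℕ → ℕ
    B k = count (Missing k)

    P : ℕ
    P = 2 ^ m

    Mc : ℕ
    Mc = suc (ℓ + s + (ℓ + s))

    indices : suc (m + m) ≡ H + H + (Mc + (H + H))
    indices = trans (cong (λ z → suc (z + z)) (sym m-split)) (regroup H s ℓ)
      where
      regroup : ∀ H s ℓ → suc (H + (s + H) + ℓ + (H + (s + H) + ℓ)) ≡ H + H + (suc (ℓ + s + (ℓ + s)) + (H + H))
      regroup = solve-∀

    window-fit : ∀ h e p → h + (e + h) + p ≤ m → ∃ λ t → h + (e + (h + (p + t))) ≡ m
    window-fit h e p le with m≤n⇒∃[o]m+o≡n le
    ... | t , eq = t , trans (regroup h e p t) eq
      where
      regroup : ∀ h e p t → h + (e + (h + (p + t))) ≡ h + (e + h) + p + t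
      regroup = solve-∀

    tail-index : ∀ h e → e ≤ 1 → h < H → h + (e + h) < H + H
    tail-index h e e≤1 h<H = begin-strict
        h + (e + h)    ≤⟨ +-monoʳ-≤ h (+-monoˡ-≤ h e≤1) ⟩
        h + suc h      <⟨ +-monoˡ-< (suc h) (n<1+n h) ⟩
        suc h + suc h  ≤⟨ +-mono-≤ h<H h<H ⟩
        H + H          ∎
      where open ≤-Reasoning

    short-window : ∀ h e → e ≤ 1 → h < H → h + (e + h) + ℓ ≤ m
    short-window h e e≤1 h<H = begin
        h + (e + h) + ℓ      ≤⟨ +-monoˡ-≤ ℓ (<⇒≤ (tail-index h e e≤1 h<H)) ⟩
        H + H + ℓ            ≤⟨ +-monoˡ-≤ ℓ (+-monoʳ-≤ H (m≤n+m H s)) ⟩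
        H + (s + H) + ℓ      ≡⟨ m-split ⟩
        m                    ∎
      where open ≤-Reasoning

    left-tail : sumTo (H + H) B * 2 ^ card L ≤ 6 * P
    left-tail = paired-geometric H B (2 ^ card L) P term
      where
      term : ∀ h e → e ≤ 1 → h < H → B (h + (e + h)) * 2 ^ card L * 2 ^ (h + (e + h)) ≤ 3 ^ h * P
      term h e e≤1 h<H with window-fit h e ℓ (short-window h e e≤1 h<H)
      ... | t , eq = subst (λ z → B (h + (e + h)) * 2 ^ z * 2 ^ (h + (e + h)) ≤ 3 ^ h * P) (card-reverse L)
                       (left-bound h e t (reverse L) e≤1 eq (λ q Lq → Lq))

    -- Right tail, read backwards: the k′-th index from the end is x k with
    -- k + k′ = 2m.
    mirror-index : ∀ k′ → k′ < H + H → H + H + (Mc + (H + H ∸ suc k′)) + k′ ≡ m + m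
    mirror-index k′ k′<2H = suc-injective (begin
        suc (H + H + (Mc + (H + H ∸ suc k′)) + k′)  ≡⟨ regroup (H + H) Mc (H + H ∸ suc k′) k′ ⟩
        H + H + (Mc + (H + H ∸ suc k′ + suc k′))    ≡⟨ cong (λ z → H + H + (Mc + z)) (m∸n+n≡m k′<2H) ⟩
        H + H + (Mc + (H + H))                      ≡⟨ sym indices ⟩
        suc (m + m)                                 ∎)
      where
      open ≡-Reasoning
      regroup : ∀ a b c k → suc (a + (b + c) + k) ≡ a + (b + (c + suc k))
      regroup = solve-∀

    right-tail : sumTo (H + H) (λ i → B (H + H + (Mc + i))) * 2 ^ card R₀ ≤ 6 * P
    right-tail = subst (λ z → z * 2 ^ card R₀ ≤ 6 * P) (sumTo-reflect (H + H) g)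
      (paired-geometric H (λ i → g (H + H ∸ suc i)) (2 ^ card R₀) P term)
      where
      g : ℕ → ℕ
      g i = B (H + H + (Mc + i))
      term : ∀ h e → e ≤ 1 → h < H → g (H + H ∸ suc (h + (e + h))) * 2 ^ card R₀ * 2 ^ (h + (e + h)) ≤ 3 ^ h * P
      term h e e≤1 h<H with window-fit h e ℓ (short-window h e e≤1 h<H)
      ... | t , eq = right-bound h e t R₀ _ e≤1 eq
                       (mirror-index (h + (e + h)) (tail-index h e e≤1 h<H))
                       (λ q Rq → Rq)

    -- Middle block: every index is at distance at least 2H from both ends of
    -- the interval, so each event has probability at most (3/4)^H.
    far-from-ends : ∀ k h e → e ≤ 1 → H + H ≤ h + (e + h) →
      B k * 2 ^ (h + (e + h)) ≤ 3 ^ h * P → B k * 4 ^ H ≤ 3 ^ H * P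
    far-from-ends k h e e≤1 far bound =
      trade (B k) (2 ^ (h + (e + h))) (3 ^ h) (4 ^ H) (3 ^ H) P bound
        (decay H h e (half-≤ H h e e≤1 far)) {{m^n≢0 2 (h + (e + h))}}

    -- Middle indices in the lower half use the window at the left end, those in
    -- the upper half the mirrored one (with no help from L or R₀).
    middle-low : ∀ k → H + H ≤ k → k ≤ m → B k * 4 ^ H ≤ 3 ^ H * P
    middle-low k far k≤m with halve k
    ... | h , e , e≤1 , refl with window-fit h e 0 (subst (_≤ m) (sym (+-identityʳ k)) k≤m)
    ...   | t , eq = far-from-ends k h e e≤1 far
                       (subst (_≤ 3 ^ h * P) (cong (_* 2 ^ k) (*-identityʳ (B k)))
                         (left-bound h e t [] e≤1 eq (λ q ())))

    middle-high : ∀ k k′ → H + H ≤ k′ → k′ ≤ m → k + k′ ≡ m + m → B k * 4 ^ H ≤ 3 ^ H * P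
    middle-high k k′ far k′≤m kk′ with halve k′
    ... | h , e , e≤1 , refl with window-fit h e 0 (subst (_≤ m) (sym (+-identityʳ k′)) k′≤m)
    ...   | t , eq = far-from-ends k h e e≤1 far
                       (subst (_≤ 3 ^ h * P) (cong (_* 2 ^ k′) (*-identityʳ (B k)))
                         (right-bound h e t [] k e≤1 eq kk′ (λ q ())))

    middle-room : ∀ i → i < Mc → H + H + i + (H + H) ≤ m + m
    middle-room i i<Mc = ≤-pred (begin
        suc (H + H + i + (H + H))    ≡⟨ regroup (H + H) i ⟩
        H + H + (suc i + (H + H))    ≤⟨ +-monoʳ-≤ (H + H) (+-monoˡ-≤ (H + H) i<Mc) ⟩
        H + H + (Mc + (H + H))       ≡⟨ sym indices ⟩
        suc (m + m)                  ∎)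
      where
      open ≤-Reasoning
      regroup : ∀ a i → suc (a + i + a) ≡ a + (suc i + a)
      regroup = solve-∀

    middle-term : ∀ i → i < Mc → B (H + H + i) * 4 ^ H ≤ 3 ^ H * P
    middle-term i i<Mc with H + H + i ≤? m
    ... | yes k≤m = middle-low (H + H + i) (m≤m+n (H + H) i) k≤m
    ... | no  k≰m with m≤n⇒∃[o]m+o≡n (≤-trans (m≤m+n (H + H + i) (H + H)) (middle-room i i<Mc))
    ...   | k′ , kk′ = middle-high (H + H + i) k′ far k′≤m kk′
      where
      far : H + H ≤ k′
      far = +-cancelˡ-≤ (H + H + i) (H + H) k′ (subst (H + H + i + (H + H) ≤_) (sym kk′) (middle-room i i<Mc))
      k′≤m : k′ ≤ m
      k′≤m = +-cancelˡ-≤ m k′ m (≤-trans (+-monoˡ-≤ k′ (<⇒≤ (≰⇒> k≰m))) (≤-reflexive kk′))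

    middle : sumTo Mc (λ i → B (H + H + i)) * 4 ^ H ≤ Mc * (3 ^ H * P)
    middle = sumTo-bound Mc (λ i → B (H + H + i)) (4 ^ H) (3 ^ H * P) middle-term

    count-not-good-split : count (λ M → not (good ℓ r L R₀ M)) ≤
      sumTo (H + H) B + (sumTo Mc (λ i → B (H + H + i)) + sumTo (H + H) (λ i → B (H + H + (Mc + i))))
    count-not-good-split = ≤-trans count-not-good (≤-reflexive (begin
        sumTo (suc (m + m)) B
      ≡⟨ cong (λ n → sumTo n B) indices ⟩
        sumTo (H + H + (Mc + (H + H))) B
      ≡⟨ sumTo-+ (H + H) (Mc + (H + H)) B ⟩
        sumTo (H + H) B + sumTo (Mc + (H + H)) (λ i → B (H + H + i))
      ≡⟨ cong (sumTo (H + H) B +_) (sumTo-+ Mc (H + H) (λ i → B (H + H + i))) ⟩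
        sumTo (H + H) B + (sumTo Mc (λ i → B (H + H + i)) + sumTo (H + H) (λ i → B (H + H + (Mc + i)))) ∎))
      where open ≡-Reasoning

    -- For H ≥ 3D(2ℓ + 3) the whole middle block has probability at most 1/D:
    -- Mc (3/4)^H ≤ (2ℓ + 3)(3/4)^H ≤ (H + 3)(3/4)^H / (3D) ≤ 1/D.
    middle-density : ∀ D → 3 * D * (2 * ℓ + 3) ≤ H → sumTo Mc (λ i → B (H + H + i)) * D ≤ P
    middle-density D H₀≤H = *-cancelʳ-≤ (sM * D) P (4 ^ H) {{m^n≢0 4 H}} (begin
        sM * D * 4 ^ H          ≡⟨ regroup sM D (4 ^ H) ⟩
        D * (sM * 4 ^ H)        ≤⟨ *-monoʳ-≤ D middle ⟩
        D * (Mc * (3 ^ H * P))  ≡⟨ regroup′ D Mc (3 ^ H) P ⟩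
        P * (D * Mc * 3 ^ H)    ≤⟨ *-monoʳ-≤ P small ⟩
        P * 4 ^ H               ∎)
      where
      open ≤-Reasoning
      sM : ℕ
      sM = sumTo Mc (λ i → B (H + H + i))
      regroup : ∀ a b c → a * b * c ≡ b * (a * c)
      regroup = solve-∀
      regroup′ : ∀ D M t P → D * (M * (t * P)) ≡ P * (D * M * t)
      regroup′ = solve-∀
      Mc≤ : Mc ≤ 2 * ℓ + 3
      Mc≤ = begin
          suc (ℓ + s + (ℓ + s))  ≤⟨ s≤s (+-mono-≤ (+-monoʳ-≤ ℓ s≤1) (+-monoʳ-≤ ℓ s≤1)) ⟩
          suc (ℓ + 1 + (ℓ + 1))  ≡⟨ three ℓ ⟩
          2 * ℓ + 3              ∎
        where
        three : ∀ ℓ → suc (ℓ + 1 + (ℓ + 1)) ≡ 2 * ℓ + 3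
        three = solve-∀
      small : D * Mc * 3 ^ H ≤ 4 ^ H
      small = *-cancelˡ-≤ 3 (begin
          3 * (D * Mc * 3 ^ H)           ≡⟨ regroup″ D Mc (3 ^ H) ⟩
          3 * D * Mc * 3 ^ H             ≤⟨ *-monoˡ-≤ (3 ^ H) (*-monoʳ-≤ (3 * D) Mc≤) ⟩
          3 * D * (2 * ℓ + 3) * 3 ^ H    ≤⟨ *-monoˡ-≤ (3 ^ H) (≤-trans H₀≤H (m≤m+n H 3)) ⟩
          (H + 3) * 3 ^ H                ≤⟨ grow H ⟩
          3 * 4 ^ H                      ∎)
        where
        regroup″ : ∀ D M t → 3 * (D * M * t) ≡ 3 * D * M * t
        regroup″ = solve-∀

module Decomposition where
  open import Defs
  open Counting
  open Series using (halve; half-≤)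
  open import Data.Bool using (Bool; not)
  open import Data.Nat using (ℕ; _+_; _*_; _^_; _∸_; _≤_; _<_)
  open import Data.Nat.Properties
  open import Data.Vec using (Vec)
  open import Data.Product using (_,_)
  open import Relation.Binary.PropositionalEquality
  open import Data.Nat.Tactic.RingSolver using (solve-∀)

  record BadSplit (ℓ r : ℕ) (L R₀ : Vec Bool ℓ) (D : ℕ) : Set where
    field
      sL sM sR : ℕ
      covers : count (λ M → not (good ℓ r L R₀ M)) ≤ sL + (sM + sR)
      left   : sL * 2 ^ card L ≤ 6 * 2 ^ (r ∸ 2 * ℓ)
      right  : sR * 2 ^ card R₀ ≤ 6 * 2 ^ (r ∸ 2 * ℓ)
      middle : sM * D ≤ 2 ^ (r ∸ 2 * ℓ)

  -- The tails need length H ≥ 3D(2ℓ + 3), so m - ℓ ≥ 2H.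
  threshold : ℕ → ℕ → ℕ
  threshold ℓ D = 3 * D * (2 * ℓ + 3) + 3 * D * (2 * ℓ + 3) + 3 * ℓ

  bad-split : ∀ ℓ r (L R₀ : Vec Bool ℓ) → 0 < ℓ → 2 * ℓ ≤ r → ∀ D → threshold ℓ D ≤ r →
    BadSplit ℓ r L R₀ D
  bad-split ℓ r L R₀ ℓ>0 2ℓ≤r D large with halve (r ∸ 2 * ℓ ∸ ℓ)
  ... | H , s , s≤1 , split = record
    { sL = sumTo (H + H) B
    ; sM = sumTo Mc (λ i → B (H + H + i))
    ; sR = sumTo (H + H) (λ i → B (H + H + (Mc + i)))
    ; covers = count-not-good-split
    ; left = left-tail
    ; right = right-tail
    ; middle = middle-density D H₀≤H
    }
    where
    open Configuration ℓ r L R₀ ℓ>0 2ℓ≤r using (m; r≡)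
    open Series using (sumTo)
    H₀ : ℕ
    H₀ = 3 * D * (2 * ℓ + 3)
    room : H₀ + H₀ + ℓ ≤ m
    room = +-cancelˡ-≤ (ℓ + ℓ) _ _
      (subst₂ _≤_ (regroup H₀ ℓ) (sym (+-assoc ℓ ℓ m)) (subst (threshold ℓ D ≤_) r≡ large))
      where
      regroup : ∀ H₀ ℓ → H₀ + H₀ + 3 * ℓ ≡ ℓ + ℓ + (H₀ + H₀ + ℓ)
      regroup = solve-∀
    ℓ≤m : ℓ ≤ m
    ℓ≤m = ≤-trans (m≤n+m ℓ (H₀ + H₀)) room
    m-split : H + (s + H) + ℓ ≡ m
    m-split = trans (cong (_+ ℓ) split) (m∸n+n≡m ℓ≤m)
    H₀≤H : H₀ ≤ H
    H₀≤H = half-≤ H₀ H s s≤1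
      (+-cancelʳ-≤ ℓ (H₀ + H₀) (H + (s + H)) (subst (H₀ + H₀ + ℓ ≤_) (sym m-split) room))
    open Configuration.IntervalSplit ℓ r L R₀ ℓ>0 2ℓ≤r H s s≤1 m-split

module ProbabilityBound where
  open import Defs using (inv2^)
  open import Data.Nat as ℕ using (ℕ; suc; NonZero; pred)
  import Data.Nat.Properties as ℕ
  open import Data.Integer as ℤ using (+_; +0; +[1+_]; -[1+_])
  import Data.Integer.Properties as ℤ
  open import Data.Rational as ℚ using (ℚ; mkℚ; 0ℚ; 1ℚ; toℚᵘ)
  import Data.Rational.Properties as ℚ
  open import Data.Rational.Unnormalised as ℚᵘ
    using (ℚᵘ; mkℚᵘ; *≤*; *≡*; 1ℚᵘ; _≃_; _≤_; _+_; _-_; _*_; -_)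
  import Data.Rational.Unnormalised.Properties as ℚᵘ
  open import Relation.Binary.PropositionalEquality using (_≡_; refl; sym; trans; cong; cong₂; subst; subst₂)
  open import Data.Nat.Tactic.RingSolver using (solve-∀)
  open import Data.Empty using (⊥-elim)

  -- frac a p is the unnormalised fraction a / (p + 1).
  frac : ℕ → ℕ → ℚᵘ
  frac a p = mkℚᵘ (+ a) p

  toℚᵘ-/ : ∀ a n .{{_ : NonZero n}} → toℚᵘ (+ a ℚ./ n) ≃ frac a (pred n)
  toℚᵘ-/ a (suc p) = ℚ.toℚᵘ-fromℚᵘ (frac a p)

  frac-≤ : ∀ a b c d → a ℕ.* suc d ℕ.≤ c ℕ.* suc b → frac a b ≤ frac c d
  frac-≤ a b c d h = *≤* (subst₂ ℤ._≤_ (ℤ.pos-* a (suc d)) (ℤ.pos-* c (suc b)) (ℤ.+≤+ h))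

  frac-+ : ∀ a c p → frac a p + frac c p ≃ frac (a ℕ.+ c) p
  frac-+ a c p = *≡* (begin
      (+ a ℤ.* + q ℤ.+ + c ℤ.* + q) ℤ.* + q
    ≡⟨ cong₂ (λ x y → (x ℤ.+ y) ℤ.* + q) (sym (ℤ.pos-* a q)) (sym (ℤ.pos-* c q)) ⟩
      (+ (a ℕ.* q) ℤ.+ + (c ℕ.* q)) ℤ.* + q
    ≡⟨ cong (ℤ._* + q) (sym (ℤ.pos-+ (a ℕ.* q) (c ℕ.* q))) ⟩
      + (a ℕ.* q ℕ.+ c ℕ.* q) ℤ.* + q
    ≡⟨ sym (ℤ.pos-* (a ℕ.* q ℕ.+ c ℕ.* q) q) ⟩
      + ((a ℕ.* q ℕ.+ c ℕ.* q) ℕ.* q)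
    ≡⟨ cong +_ (regroup a c q) ⟩
      + ((a ℕ.+ c) ℕ.* (q ℕ.* q))
    ≡⟨ ℤ.pos-* (a ℕ.+ c) (q ℕ.* q) ⟩
      + (a ℕ.+ c) ℤ.* + (q ℕ.* q) ∎)
    where
    open Relation.Binary.PropositionalEquality.≡-Reasoning
    q : ℕ
    q = suc p
    regroup : ∀ a c q → (a ℕ.* q ℕ.+ c ℕ.* q) ℕ.* q ≡ (a ℕ.+ c) ℕ.* (q ℕ.* q)
    regroup = solve-∀

  frac-one : ∀ p → frac (suc p) p ≃ 1ℚᵘ
  frac-one p = *≡* (trans (ℤ.*-identityʳ (+ suc p)) (sym (ℤ.*-identityˡ (+ suc p))))

  six-over-2^ : ∀ α s p → s ℕ.* 2 ℕ.^ α ℕ.≤ 6 ℕ.* suc p →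
    frac s p ≤ toℚᵘ (+ 6 ℚ./ 1) * toℚᵘ (inv2^ α)
  six-over-2^ α s p bound = ℚᵘ.≤-respʳ-≃ (ℚᵘ.≃-sym product)
    (frac-≤ s p 6 (pred A)
      (subst (λ z → s ℕ.* z ℕ.≤ 6 ℕ.* suc p) (sym (ℕ.suc-pred A {{ℕ.m^n≢0 2 α}})) bound))
    where
    A : ℕ
    A = 2 ℕ.^ α
    product : toℚᵘ (+ 6 ℚ./ 1) * toℚᵘ (inv2^ α) ≃ frac 6 (pred A)
    product = ℚᵘ.≃-trans (ℚᵘ.*-cong (toℚᵘ-/ 6 1) (toℚᵘ-/ 1 A {{ℕ.m^n≢0 2 α}})) (*≡* (begin
        (+ 6 ℤ.* + 1) ℤ.* + suc (pred A)  ≡⟨ cong (ℤ._* + suc (pred A)) (ℤ.*-identityʳ (+ 6)) ⟩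
        + 6 ℤ.* + suc (pred A)            ≡⟨ cong (λ z → + 6 ℤ.* + z) (sym (ℕ.+-identityʳ (suc (pred A)))) ⟩
        + 6 ℤ.* + (suc (pred A) ℕ.+ 0)    ∎))
      where open Relation.Binary.PropositionalEquality.≡-Reasoning

  below-ε : ∀ (ε : ℚ) → 0ℚ ℚ.< ε → ∀ s p → s ℕ.* ℚ.↧ₙ ε ℕ.≤ suc p → frac s p ≤ toℚᵘ ε
  below-ε (mkℚ +[1+ k ] d _) _   s p bound = frac-≤ s p (suc k) d (ℕ.≤-trans bound (ℕ.m≤n*m (suc p) (suc k)))
  below-ε ε@(mkℚ +0 d _)        ε>0 s p _ =
    ⊥-elim (ℚ.<-irrefl refl (subst (0ℚ ℚ.<_) (ℚ.↥p≡0⇒p≡0 ε refl) ε>0))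
  below-ε ε@(mkℚ -[1+ n ] d _)  ε>0 s p _ = ⊥-elim (ℚ.<-asym ε>0 (ℚ.negative⁻¹ ε))

  complement : ∀ g b y e → g + b ≃ 1ℚᵘ → b ≤ y + e → 1ℚᵘ - y - e ≤ g
  complement g b y e g+b≃1 b≤ = ℚᵘ.≤-trans (ℚᵘ.≤-reflexive rearrange)
    (ℚᵘ.≤-trans (ℚᵘ.+-monoʳ-≤ 1ℚᵘ (ℚᵘ.neg-mono-≤ b≤)) (ℚᵘ.≤-reflexive cancel))
    where
    rearrange : 1ℚᵘ - y - e ≃ 1ℚᵘ + - (y + e)
    rearrange = ℚᵘ.≃-trans (ℚᵘ.+-assoc 1ℚᵘ (- y) (- e))
                  (ℚᵘ.≃-reflexive (cong (λ z → 1ℚᵘ + z) (sym (ℚᵘ.neg-distrib-+ y e))))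
    cancel : 1ℚᵘ + - b ≃ g
    cancel = ℚᵘ.≃-trans (ℚᵘ.+-congˡ (- b) (ℚᵘ.≃-sym g+b≃1))
               (ℚᵘ.≃-trans (ℚᵘ.+-assoc g b (- b))
                 (ℚᵘ.≃-trans (ℚᵘ.+-congʳ g (ℚᵘ.+-inverseʳ b)) (ℚᵘ.+-identityʳ g)))

  toℚᵘ-- : ∀ p q → toℚᵘ (p ℚ.- q) ≃ toℚᵘ p - toℚᵘ q
  toℚᵘ-- p q = ℚᵘ.≃-trans (ℚ.toℚᵘ-homo-+ p (ℚ.- q)) (ℚᵘ.+-congʳ (toℚᵘ p) (ℚ.toℚᵘ-homo‿- q))

  probability-bound : ∀ α β (ε : ℚ) → 0ℚ ℚ.< ε → ∀ P G bad sL sM sR .{{_ : NonZero P}} →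
    G ℕ.+ bad ≡ P → bad ℕ.≤ sL ℕ.+ (sM ℕ.+ sR) →
    sL ℕ.* 2 ℕ.^ α ℕ.≤ 6 ℕ.* P → sR ℕ.* 2 ℕ.^ β ℕ.≤ 6 ℕ.* P → sM ℕ.* ℚ.↧ₙ ε ℕ.≤ P →
    1ℚ ℚ.- (+ 6 ℚ./ 1) ℚ.* (inv2^ α ℚ.+ inv2^ β) ℚ.- ε ℚ.≤ (+ G ℚ./ P)
  probability-bound α β ε ε>0 (suc p) G bad sL sM sR G+bad bad≤ left right middle =
    ℚ.toℚᵘ-cancel-≤ (ℚᵘ.≤-respˡ-≃ (ℚᵘ.≃-sym lhs) (ℚᵘ.≤-respʳ-≃ (ℚᵘ.≃-sym (toℚᵘ-/ G (suc p)))
      (complement (frac G p) (frac bad p) (six * (a + b)) e whole parts)))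
    where
    six a b e : ℚᵘ
    six = toℚᵘ (+ 6 ℚ./ 1)
    a = toℚᵘ (inv2^ α)
    b = toℚᵘ (inv2^ β)
    e = toℚᵘ ε
    lhs : toℚᵘ (1ℚ ℚ.- (+ 6 ℚ./ 1) ℚ.* (inv2^ α ℚ.+ inv2^ β) ℚ.- ε) ≃ 1ℚᵘ - six * (a + b) - e
    lhs = ℚᵘ.≃-trans (toℚᵘ-- (1ℚ ℚ.- (+ 6 ℚ./ 1) ℚ.* (inv2^ α ℚ.+ inv2^ β)) ε)
            (ℚᵘ.+-congˡ (- e) (ℚᵘ.≃-trans (toℚᵘ-- 1ℚ ((+ 6 ℚ./ 1) ℚ.* (inv2^ α ℚ.+ inv2^ β)))
              (ℚᵘ.+-congʳ 1ℚᵘ (ℚᵘ.-‿cong (ℚᵘ.≃-trans (ℚ.toℚᵘ-homo-* (+ 6 ℚ./ 1) (inv2^ α ℚ.+ inv2^ β))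
                (ℚᵘ.*-congˡ {six} (ℚ.toℚᵘ-homo-+ (inv2^ α) (inv2^ β))))))))
    whole : frac G p + frac bad p ≃ 1ℚᵘ
    whole = ℚᵘ.≃-trans (frac-+ G bad p)
              (ℚᵘ.≃-trans (ℚᵘ.≃-reflexive (cong (λ z → frac z p) G+bad)) (frac-one p))
    parts : frac bad p ≤ six * (a + b) + e
    parts = begin
        frac bad p
      ≤⟨ frac-≤ bad p (sL ℕ.+ (sR ℕ.+ sM)) p
           (ℕ.*-monoˡ-≤ (suc p) (ℕ.≤-trans bad≤ (ℕ.≤-reflexive (cong (sL ℕ.+_) (ℕ.+-comm sM sR))))) ⟩
        frac (sL ℕ.+ (sR ℕ.+ sM)) p
      ≃⟨ ℚᵘ.≃-sym (ℚᵘ.≃-trans (ℚᵘ.+-congʳ (frac sL p) (frac-+ sR sM p)) (frac-+ sL (sR ℕ.+ sM) p)) ⟩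
        frac sL p + (frac sR p + frac sM p)
      ≤⟨ ℚᵘ.+-mono-≤ (six-over-2^ α sL p left)
           (ℚᵘ.+-mono-≤ (six-over-2^ β sR p right) (below-ε ε ε>0 sM p middle)) ⟩
        six * a + (six * b + e)
      ≃⟨ ℚᵘ.≃-sym (ℚᵘ.+-assoc (six * a) (six * b) e) ⟩
        six * a + six * b + e
      ≃⟨ ℚᵘ.+-congˡ e (ℚᵘ.≃-sym (ℚᵘ.*-distribˡ-+ six a b)) ⟩
        six * (a + b) + e ∎
      where open ℚᵘ.≤-Reasoning

open import Defs
open import Data.Bool using (not; T?)
open import Data.Nat.Properties using (m^n≢0; <⇒≤)
open import Data.Integer using (+_)
open import Data.Product using (∃; _,_)
open import Data.List using (length; filter)
open import Data.Rational using (ℚ; 0ℚ; 1ℚ; _+_; _-_; _*_; _≤_; _<_; _/_; ↧ₙ_)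
open import Relation.Binary.PropositionalEquality using (_≡_; trans; cong)
open Counting using (count; count-allSubsets; count-not)
open Decomposition using (threshold; bad-split; module BadSplit)
open ProbabilityBound using (probability-bound)

-- With D the denominator of ε, r₀ = threshold ℓ D works: for r ≥ r₀ the
-- bad outcomes split as in `bad-split`, and `probability-bound` turns the
-- counts into the stated inequality for prob = #good / 2^m.
lemmaB1 : (ℓ : ℕ) → 0 ℕ.< ℓ → (L R₀ : Vec Bool ℓ) →
    (ε : ℚ) → 0ℚ < ε →
    ∃ λ (r₀ : ℕ) → (r : ℕ) → r₀ ℕ.≤ r → 2 ℕ.* ℓ ℕ.< r →
      1ℚ - (+ 6 / 1) * (inv2^ (card L) + inv2^ (card R₀)) - ε ≤ prob ℓ r L R₀
lemmaB1 ℓ ℓ>0 L R₀ ε ε>0 = threshold ℓ (↧ₙ ε) , bound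
  where
  bound : (r : ℕ) → threshold ℓ (↧ₙ ε) ℕ.≤ r → 2 ℕ.* ℓ ℕ.< r →
    1ℚ - (+ 6 / 1) * (inv2^ (card L) + inv2^ (card R₀)) - ε ≤ prob ℓ r L R₀
  bound r large 2ℓ<r =
    probability-bound (card L) (card R₀) ε ε>0 (2 ℕ.^ m) _ _ sL sM sR {{m^n≢0 2 m}}
      partition covers left right middle
    where
    m : ℕ
    m = r ℕ.∸ 2 ℕ.* ℓ
    open BadSplit (bad-split ℓ r L R₀ ℓ>0 (<⇒≤ 2ℓ<r) (↧ₙ ε) large)
    partition : length (filter (λ M → T? (good ℓ r L R₀ M)) (allSubsets m)) ℕ.+ count (λ M → not (good ℓ r L R₀ M))
                ≡ 2 ℕ.^ m
    partition = trans (cong (ℕ._+ count (λ M → not (good ℓ r L R₀ M))) (count-allSubsets m (good ℓ r L R₀)))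
                      (count-not (good ℓ r L R₀))
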